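{- The graph $T_{\aleph_0} * t$ is not a minor of the Farey graph.
   Context: $H$ is a minor of $G$ if there are disjoint non-empty vertex sets $V_h\subseteq V(G)$ ($h\in V(H)$), each inducing a connected subgraph, with a $V_h$–$V_{h'}$ edge in $G$ whenever $hh'\in E(H)$. The Farey graph is the graph on $\mathbb{Q}\cup\{\infty\}$ in which $a/b$ and $c/d$ in lowest terms (with $\infty=(\pm1)/0$) are adjacent iff $ad-bc=\pm1$. $T_{\aleph_0}$ is the tree in which every vertex has countably infinite degree, and $T_{\aleph_0}*t$ is obtained from it by adding a new vertex $t$ adjacent to all its vertices. -}

module Defs where

open import Data.Nat using (ℕ)
open import Data.Integer as ℤ using (ℤ; +_; _*_; _-_; ∣_∣)
open import Data.Rational using (ℚ; ↥_; ↧_)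
open import Data.Maybe using (Maybe; just; nothing)
open import Data.List using (List; _∷_)
open import Data.Product using (Σ; ∃; _×_)
open import Data.Unit using (⊤)
open import Data.Sum using (_⊎_)
open import Data.Empty using (⊥)
open import Relation.Nullary using (¬_)
open import Relation.Binary.PropositionalEquality using (_≡_)

record Graph : Set₁ where
  field
    Vertex : Set
    _~_    : Vertex → Vertex → Set
open Graph public

data WalkIn (G : Graph) (P : Vertex G → Set) : Vertex G → Vertex G → Set where
  here : ∀ {u} → P u → WalkIn G P u u
  step : ∀ {u w v} → P u → _~_ G u w → WalkIn G P w v → WalkIn G P u v

InducesConnected : (G : Graph) → (Vertex G → Set) → Set
InducesConnected G P = ∀ u v → P u → P v → WalkIn G P u v

record MinorModel (H G : Graph) : Set₁ where
  field
    branch    : Vertex H → Vertex G → Set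
    nonempty  : ∀ h → ∃ λ v → branch h v
    disjoint  : ∀ h h' → ¬ (h ≡ h') → ∀ v → branch h v → branch h' v → ⊥
    connected : ∀ h → InducesConnected G (branch h)
    edges     : ∀ h h' → _~_ H h h' →
                ∃ λ u → ∃ λ v → branch h u × branch h' v × _~_ G u v

IsMinor : Graph → Graph → Set₁
IsMinor H G = MinorModel H G

-- Farey graph on ℚ ∪ {∞}; nothing = ∞ = 1/0. Rationals are stored in lowest
-- terms (positive denominator), so ↥/↧ give the reduced numerator/denominator.
num : Maybe ℚ → ℤ
num nothing  = + 1
num (just q) = ↥ q

den : Maybe ℚ → ℤ
den nothing  = + 0
den (just q) = ↧ q

Farey : Graph
Farey = record
  { Vertex = Maybe ℚ
  ; _~_    = λ x y → ∣ num x * den y - den x * num y ∣ ≡ 1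
  }

-- T_{ℵ₀}: vertices are finite sequences of naturals; w is adjacent to n ∷ w.
-- Every vertex has countably infinitely many neighbours, and it is a tree.
TreeAdj : List ℕ → List ℕ → Set
TreeAdj x y = (∃ λ n → y ≡ n ∷ x) ⊎ (∃ λ n → x ≡ n ∷ y)

Tℵ₀ : Graph
Tℵ₀ = record { Vertex = List ℕ ; _~_ = TreeAdj }

-- T_{ℵ₀} * t : add a new vertex t (= nothing) adjacent to every vertex of T_{ℵ₀}.
ConeAdj : Maybe (List ℕ) → Maybe (List ℕ) → Set
ConeAdj nothing  nothing  = ⊥
ConeAdj nothing  (just _) = ⊤
ConeAdj (just _) nothing  = ⊤
ConeAdj (just x) (just y) = TreeAdj x y

Tℵ₀*t : Graph
Tℵ₀*t = record { Vertex = Maybe (List ℕ) ; _~_ = ConeAdj }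

-- Order ℚ ∪ {∞} linearly with ∞ on top. By the Plücker identity two vertex-disjoint Farey
-- edges never cross: both ends of one lie on the same side of the other. Walking along
-- them, two disjoint connected vertex sets X and Y never interleave: any two points of X
-- lie on the same side of any two points of Y. In a model of T_ℵ₀ * t choose a point a in
-- the apex branch and cᵢ in the branches of three leaves i. The apex with leaf i, and the
-- root with the other two leaves j, k, span disjoint connected sets, so a lies on the same
-- side of {cⱼ, cₖ} as cᵢ for each i; this is impossible, as exactly one of c₁, c₂, c₃ lies
-- between the other two.
module Submission where

open import Defs
open import Relation.Nullary using (¬_; contradiction)
open import Data.Maybe using (Maybe; just; nothing)
open import Data.Rational using (ℚ; ↥_; ↧_; *≡*)
import Data.Rational.Properties as ℚP
open import Data.List using ([]; _∷_)
open import Data.Product using (∃; _×_; _,_; proj₁; proj₂)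
open import Data.Sum using (inj₁; inj₂; [_,_]′)
open import Data.Unit using (tt)
open import Data.Nat as ℕ using (ℕ)
open import Data.Integer using (ℤ; +_; -[1+_]; +[1+_]; _*_; _-_; -_; ∣_∣)
import Data.Integer.Properties as ℤP
import Data.Nat.Properties as ℕP
open import Data.Integer.Tactic.RingSolver using (solve-∀)
open import Data.Bool using (Bool; true; false; not; _xor_)
open import Data.Bool.Properties
  using (not-injective; xor-assoc; xor-comm; xor-same; xor-inverseˡ; xor-inverseʳ)
open import Relation.Unary using (Pred; _∈_; _⊆_; _∪_; _⊥_; ｛_｝)
open import Relation.Binary.PropositionalEquality
open import Function using (_∘_)
open import Level using (0ℓ)

xor-swap : ∀ a b c d → a xor b ≡ c xor d → a xor c ≡ b xor d
xor-swap false b false d b≡d rewrite b≡d = sym (xor-same d)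
xor-swap false b true  d b≡¬d rewrite b≡¬d = sym (xor-inverseˡ d)
xor-swap true  b false d ¬b≡d rewrite sym ¬b≡d = sym (xor-inverseʳ b)
xor-swap true  b true  d ¬b≡¬d rewrite not-injective ¬b≡¬d = sym (xor-same d)

xor-telescope : ∀ a b c → (a xor b) xor (b xor c) ≡ a xor c
xor-telescope a b c = begin
  (a xor b) xor (b xor c)  ≡⟨ xor-assoc a b (b xor c) ⟩
  a xor (b xor (b xor c))  ≡⟨ cong (a xor_) (sym (xor-assoc b b c)) ⟩
  a xor ((b xor b) xor c)  ≡⟨ cong (λ x → a xor (x xor c)) (xor-same b) ⟩
  a xor c                  ∎
  where open ≡-Reasoning

xor-triangle : ∀ a b c {a' b' c'} → a' ≡ not a → b' ≡ not b → c' ≡ not c →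
               ((a xor b) xor (c xor a')) xor (c' xor b') ≡ true
xor-triangle false false false refl refl refl = refl
xor-triangle false false true  refl refl refl = refl
xor-triangle false true  false refl refl refl = refl
xor-triangle false true  true  refl refl refl = refl
xor-triangle true  false false refl refl refl = refl
xor-triangle true  false true  refl refl refl = refl
xor-triangle true  true  false refl refl refl = refl
xor-triangle true  true  true  refl refl refl = refl

positive : ℤ → Bool
positive +[1+ _ ] = true
positive _        = false

positive-neg : ∀ {i} → i ≢ + 0 → positive (- i) ≡ not (positive i)
positive-neg {+ 0}      i≢0 = contradiction refl i≢0
positive-neg {+[1+ _ ]} _   = refl
positive-neg { -[1+ _ ]} _  = refl

positive-* : ∀ {i j} → i ≢ + 0 → j ≢ + 0 → positive (i * j) ≡ not (positive i xor positive j)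
positive-* {+ 0}      i≢0 _   = contradiction refl i≢0
positive-* {i} {+ 0}   _   j≢0 = contradiction refl j≢0
positive-* {+[1+ _ ]} {+[1+ _ ]} _ _ = refl
positive-* {+[1+ _ ]} { -[1+ _ ]} _ _ = refl
positive-* { -[1+ _ ]} {+[1+ _ ]} _ _ = refl
positive-* { -[1+ _ ]} { -[1+ _ ]} _ _ = refl

*-≢0 : ∀ {i j} → i ≢ + 0 → j ≢ + 0 → i * j ≢ + 0
*-≢0 {i} i≢0 j≢0 = [ i≢0 , j≢0 ]′ ∘ ℤP.i*j≡0⇒i≡0∨j≡0 i

∣i-j∣≡1⇒positive≡ : ∀ {i j} → i ≢ + 0 → j ≢ + 0 → ∣ i - j ∣ ≡ 1 → positive i ≡ positive j
∣i-j∣≡1⇒positive≡ {+ 0}      i≢0 _   _ = contradiction refl i≢0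
∣i-j∣≡1⇒positive≡ {i} {+ 0}  _   j≢0 _ = contradiction refl j≢0
∣i-j∣≡1⇒positive≡ {+[1+ _ ]} {+[1+ _ ]}   _ _ _ = refl
∣i-j∣≡1⇒positive≡ {+[1+ m ]} { -[1+ n ]} _ _ eq =
  contradiction (trans (sym (ℕP.+-suc m n)) (cong ℕ.pred eq)) ℕP.1+n≢0
∣i-j∣≡1⇒positive≡ { -[1+ _ ]} {+[1+ _ ]}  _ _ ()
∣i-j∣≡1⇒positive≡ { -[1+ _ ]} { -[1+ _ ]} _ _ _ = refl

∣pq-rs∣≡1⇒positive-xor≡ : ∀ {p q r s} → p ≢ + 0 → q ≢ + 0 → r ≢ + 0 → s ≢ + 0 →
                           ∣ p * q - r * s ∣ ≡ 1 →
                           positive p xor positive q ≡ positive r xor positive s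
∣pq-rs∣≡1⇒positive-xor≡ {p} {q} {r} {s} p≢0 q≢0 r≢0 s≢0 eq = not-injective (begin
  not (positive p xor positive q)  ≡⟨ sym (positive-* p≢0 q≢0) ⟩
  positive (p * q)                 ≡⟨ ∣i-j∣≡1⇒positive≡ (*-≢0 p≢0 q≢0) (*-≢0 r≢0 s≢0) eq ⟩
  positive (r * s)                 ≡⟨ positive-* r≢0 s≢0 ⟩
  not (positive r xor positive s)  ∎)
  where open ≡-Reasoning

det : Maybe ℚ → Maybe ℚ → ℤ
det x y = num x * den y - den x * num y

det-antisym : ∀ x y → det y x ≡ - det x y
det-antisym x y = identity (num x) (den x) (num y) (den y)
  where
  identity : ∀ a b c d → c * b - d * a ≡ - (a * d - b * c)
  identity = solve-∀

det-plücker : ∀ u v z z' → det u v * det z z' ≡ det u z * det v z' - det u z' * det v z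
det-plücker u v z z' = identity (num u) (den u) (num v) (den v) (num z) (den z) (num z') (den z')
  where
  identity : ∀ a₁ b₁ a₂ b₂ a₃ b₃ a₄ b₄ →
    (a₁ * b₂ - b₁ * a₂) * (a₃ * b₄ - b₃ * a₄) ≡
    (a₁ * b₃ - b₁ * a₃) * (a₂ * b₄ - b₂ * a₄) - (a₁ * b₄ - b₁ * a₄) * (a₂ * b₃ - b₂ * a₃)
  identity = solve-∀

det≡0⇒≡ : ∀ x y → det x y ≡ + 0 → x ≡ y
det≡0⇒≡ nothing  nothing  _  = refl
det≡0⇒≡ nothing  (just q) ()
det≡0⇒≡ (just p) nothing  eq = contradiction (trans (sym (det-antisym nothing (just p))) eq) λ ()
det≡0⇒≡ (just p) (just q) eq = cong just (ℚP.≃⇒≡ (*≡* (trans p↥q↧≡ (ℤP.*-comm (↧ p) (↥ q)))))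
  where
  p↥q↧≡ : ↥ p * ↧ q ≡ ↧ p * ↥ q
  p↥q↧≡ = ℤP.i-j≡0⇒i≡j (↥ p * ↧ q) (↧ p * ↥ q) eq

-- Denominators are positive and ∞ = 1/0, so above x y holds iff x > y in ℚ ∪ {∞} with ∞ on top.
above : Maybe ℚ → Maybe ℚ → Bool
above x y = positive (det x y)

above-antisym : ∀ {x y} → x ≢ y → above y x ≡ not (above x y)
above-antisym {x} {y} x≢y =
  trans (cong positive (det-antisym x y)) (positive-neg (x≢y ∘ det≡0⇒≡ x y))

between : Maybe ℚ → Maybe ℚ → Maybe ℚ → Bool
between y y' x = above x y xor above x y'

between-split : ∀ y z w x → between y z x xor between z w x ≡ between y w x
between-split y z w x = xor-telescope (above x y) (above x z) (above x w)

between-parity : ∀ {x y z} → x ≢ y → y ≢ z → x ≢ z →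
                 (between x y z xor between y z x) xor between x z y ≡ true
between-parity x≢y y≢z x≢z =
  xor-triangle _ _ _ (above-antisym (x≢z ∘ sym)) (above-antisym (y≢z ∘ sym)) (above-antisym x≢y)

farey-edges-do-not-cross : ∀ {u v z z'} → _~_ Farey u v → _~_ Farey z z' →
                           u ≢ z → u ≢ z' → v ≢ z → v ≢ z' →
                           between z z' u ≡ between z z' v
farey-edges-do-not-cross {u} {v} {z} {z'} uv zz' u≢z u≢z' v≢z v≢z' =
  trans (xor-swap (above u z) (above v z') (above u z') (above v z) signs)
        (xor-comm (above v z') (above v z))
  where
  det≢0 : ∀ {x y} → x ≢ y → det x y ≢ + 0
  det≢0 {x} {y} x≢y = x≢y ∘ det≡0⇒≡ x y

  unimodular : ∣ det u z * det v z' - det u z' * det v z ∣ ≡ 1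
  unimodular = begin
    ∣ det u z * det v z' - det u z' * det v z ∣  ≡⟨ cong ∣_∣ (sym (det-plücker u v z z')) ⟩
    ∣ det u v * det z z' ∣                      ≡⟨ ℤP.abs-* (det u v) (det z z') ⟩
    ∣ det u v ∣ ℕ.* ∣ det z z' ∣                ≡⟨ cong₂ ℕ._*_ uv zz' ⟩
    1                                          ∎
    where open ≡-Reasoning

  signs : above u z xor above v z' ≡ above u z' xor above v z
  signs = ∣pq-rs∣≡1⇒positive-xor≡ (det≢0 u≢z) (det≢0 v≢z') (det≢0 u≢z') (det≢0 v≢z) unimodular

module _ {G : Graph} where

  walk-start : ∀ {P u v} → WalkIn G P u v → P u
  walk-start (here pu)     = pu
  walk-start (step pu _ _) = pu

  walk-map : ∀ {P Q} → P ⊆ Q → ∀ {u v} → WalkIn G P u v → WalkIn G Q u v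
  walk-map P⊆Q (here pu)        = here (P⊆Q pu)
  walk-map P⊆Q (step pu uw rest) = step (P⊆Q pu) uw (walk-map P⊆Q rest)

  walk-concat : ∀ {P u v w} → WalkIn G P u v → WalkIn G P v w → WalkIn G P u w
  walk-concat (here _)          vw = vw
  walk-concat (step pu uu' rest) vw = step pu uu' (walk-concat rest vw)

between-constant-on-walk : ∀ {X Y : Pred (Maybe ℚ) 0ℓ} → X ⊥ Y →
                           ∀ {z z'} → z ∈ Y → z' ∈ Y → _~_ Farey z z' →
                           ∀ {u w} → WalkIn Farey X u w → between z z' u ≡ between z z' w
between-constant-on-walk X⊥Y z∈Y z'∈Y zz' (here _) = refl
between-constant-on-walk {X} {Y} X⊥Y z∈Y z'∈Y zz' (step u∈X uv rest) =
  trans (farey-edges-do-not-cross uv zz' (apart u∈X z∈Y) (apart u∈X z'∈Y)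
                                         (apart v∈X z∈Y) (apart v∈X z'∈Y))
        (between-constant-on-walk X⊥Y z∈Y z'∈Y zz' rest)
  where
  v∈X : _ ∈ X
  v∈X = walk-start rest
  apart : ∀ {x y} → x ∈ X → y ∈ Y → x ≢ y
  apart x∈X y∈Y refl = X⊥Y (x∈X , y∈Y)

disjoint-walks-do-not-cross : ∀ {X Y : Pred (Maybe ℚ) 0ℓ} → X ⊥ Y →
                              ∀ {x x' y y'} → WalkIn Farey X x x' → WalkIn Farey Y y y' →
                              between y y' x ≡ between y y' x'
disjoint-walks-do-not-cross X⊥Y {x} {x'} wX (here {y} _) =
  trans (xor-same (above x y)) (sym (xor-same (above x' y)))
disjoint-walks-do-not-cross X⊥Y {x} {x'} wX (step {y} {z} {y'} y∈Y yz rest) = begin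
  between y y' x                      ≡⟨ sym (between-split y z y' x) ⟩
  between y z x xor between z y' x    ≡⟨ cong₂ _xor_ (between-constant-on-walk X⊥Y y∈Y (walk-start rest) yz wX)
                                       (disjoint-walks-do-not-cross X⊥Y wX rest) ⟩
  between y z x' xor between z y' x'  ≡⟨ between-split y z y' x' ⟩
  between y y' x'                     ∎
  where open ≡-Reasoning

module _ {H G : Graph} (M : MinorModel H G) where
  open MinorModel M

  branches : Pred (Vertex H) 0ℓ → Pred (Vertex G) 0ℓ
  branches S v = ∃ λ h → h ∈ S × branch h v

  branch⊆branches : ∀ {S h} → h ∈ S → branch h ⊆ branches S
  branch⊆branches h∈S v∈h = _ , h∈S , v∈h

  branches-disjoint : ∀ {S T} → S ⊥ T → branches S ⊥ branches T
  branches-disjoint S⊥T ((h , h∈S , v∈h) , (h' , h'∈T , v∈h')) =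
    disjoint h h' (λ { refl → S⊥T (h∈S , h'∈T) }) _ v∈h v∈h'

  walk-lift : ∀ {S h h' u v} → WalkIn H S h h' → branch h u → branch h' v →
              WalkIn G (branches S) u v
  walk-lift (here h∈S) u∈h v∈h = walk-map (branch⊆branches h∈S) (connected _ _ _ u∈h v∈h)
  walk-lift (step {h} h∈S hh₁ rest) u∈h v∈h' with edges _ _ hh₁
  ... | a , b , a∈h , b∈h₁ , ab =
    walk-concat (walk-map (branch⊆branches h∈S) (connected h _ a u∈h a∈h))
                (step (branch⊆branches h∈S a∈h) ab (walk-lift rest b∈h₁ v∈h'))

  point : Vertex H → Vertex G
  point h = proj₁ (nonempty h)

  point∈branch : ∀ h → branch h (point h)
  point∈branch h = proj₂ (nonempty h)

  points-distinct : ∀ {h h'} → h ≢ h' → point h ≢ point h'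
  points-distinct {h} {h'} h≢h' eq =
    disjoint h h' h≢h' (point h) (point∈branch h) (subst (branch h') (sym eq) (point∈branch h'))

four-points-interleave : ∀ {a x y z} → x ≢ y → y ≢ z → x ≢ z →
                         between y z a ≡ between y z x → between x z a ≡ between x z y →
                         between x y a ≢ between x y z
four-points-interleave {a} {x} {y} {z} x≢y y≢z x≢z yz-side xz-side xy-side =
  contradiction false≡true λ ()
  where
  open ≡-Reasoning
  outer-sum : Bool
  outer-sum = between x y z xor between y z x

  middle : between x z y ≡ outer-sum
  middle = begin
    between x z y                    ≡⟨ sym xz-side ⟩
    between x z a                    ≡⟨ sym (between-split x y z a) ⟩
    between x y a xor between y z a  ≡⟨ cong₂ _xor_ xy-side yz-side ⟩
    outer-sum                        ∎

  false≡true : false ≡ true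
  false≡true = begin
    false                          ≡⟨ sym (xor-same outer-sum) ⟩
    outer-sum xor outer-sum        ≡⟨ cong (outer-sum xor_) (sym middle) ⟩
    outer-sum xor between x z y    ≡⟨ between-parity x≢y y≢z x≢z ⟩
    true                           ∎

apex root : Vertex Tℵ₀*t
apex = nothing
root = just []

leaf : ℕ → Vertex Tℵ₀*t
leaf i = just (i ∷ [])

apex-to-leaf : ∀ i → WalkIn Tℵ₀*t (｛ apex ｝ ∪ ｛ leaf i ｝) apex (leaf i)
apex-to-leaf i = step (inj₁ refl) tt (here (inj₂ refl))

leaf-to-leaf : ∀ j k → WalkIn Tℵ₀*t (｛ leaf j ｝ ∪ ｛ root ｝ ∪ ｛ leaf k ｝) (leaf j) (leaf k)
leaf-to-leaf j k =
  step (inj₁ refl) (inj₂ (j , refl)) (step (inj₂ (inj₁ refl)) (inj₁ (k , refl)) (here (inj₂ (inj₂ refl))))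

apex-leaf⊥leaf-root-leaf : ∀ {i j k} → i ≢ j → i ≢ k →
                           (｛ apex ｝ ∪ ｛ leaf i ｝) ⊥ (｛ leaf j ｝ ∪ ｛ root ｝ ∪ ｛ leaf k ｝)
apex-leaf⊥leaf-root-leaf i≢j i≢k (inj₁ refl , inj₁ ())
apex-leaf⊥leaf-root-leaf i≢j i≢k (inj₁ refl , inj₂ (inj₁ ()))
apex-leaf⊥leaf-root-leaf i≢j i≢k (inj₁ refl , inj₂ (inj₂ ()))
apex-leaf⊥leaf-root-leaf i≢j i≢k (inj₂ refl , inj₁ refl)        = i≢j refl
apex-leaf⊥leaf-root-leaf i≢j i≢k (inj₂ refl , inj₂ (inj₁ ()))
apex-leaf⊥leaf-root-leaf i≢j i≢k (inj₂ refl , inj₂ (inj₂ refl)) = i≢k refl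

apex-beside-leaf : (M : MinorModel Tℵ₀*t Farey) → ∀ {i j k} → i ≢ j → i ≢ k →
                   between (point M (leaf j)) (point M (leaf k)) (point M apex) ≡
                   between (point M (leaf j)) (point M (leaf k)) (point M (leaf i))
apex-beside-leaf M {i} {j} {k} i≢j i≢k =
  disjoint-walks-do-not-cross (branches-disjoint M (apex-leaf⊥leaf-root-leaf i≢j i≢k))
    (walk-lift M (apex-to-leaf i) (point∈branch M apex) (point∈branch M (leaf i)))
    (walk-lift M (leaf-to-leaf j k) (point∈branch M (leaf j)) (point∈branch M (leaf k)))

lemma3p2 : ¬ IsMinor Tℵ₀*t Farey
lemma3p2 M =
  four-points-interleave {point M apex}
    (points-distinct M (λ ())) (points-distinct M (λ ())) (points-distinct M (λ ()))
    (apex-beside-leaf M {1} {2} {3} (λ ()) (λ ()))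
    (apex-beside-leaf M {2} {1} {3} (λ ()) (λ ()))
    (apex-beside-leaf M {3} {1} {2} (λ ()) (λ ()))
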